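{- Let $G$ be a finite digraph on $n$ vertices and let $e$ be an edge (ordered pair) whose endpoints are vertices of $G$; let $G\cup e$ denote the digraph obtained from $G$ by adding the edge $e$. Then for all natural numbers $s,t$ with $1\le s<n$, $$p_{st}(G\cup e)\ge p_{st}(G),\qquad d_{st}(G\cup e)\le d_{st}(G),\qquad v_{st}(G\cup e)\ge v_{st}(G).$$
   Context: Activation process: given a digraph $G$ with vertex set $V$, a set $S\subseteq V$ of initially active vertices and a natural number $t$ (the threshold), put $S_0=S$ and for $i\ge1$ let $S_i=S_{i-1}\cup\{v\in V\setminus S_{i-1}: v \text{ has at least } t \text{ edges } (u,v) \text{ with } u\in S_{i-1}\}$ (edges counted with multiplicity). $G$ is synchronized from $S$ if $S_i=V$ for some $i$. Let $d(S,t)$ be the smallest $i$ with $S_i=V$, and $d(S,t)=\infty$ if no such $i$ exists. An $s$-subset is a set of $s$ vertices. Define: $p_{st}(G)$ = (number of $s$-subsets $S$ from which $G$ is synchronized)/(number of all $s$-subsets); $v_{st}(G)$ by $\binom{n}{s}v_{st}(G)=\sum_{S}d(S,t)^{ -1}$, the sum over all $s$-subsets, with the convention $\infty^{ -1}=0$; and $d_{st}(G)=\max_S d(S,t)$ over all $s$-subsets $S$ (the higher diameters). If $e$ is already an edge of $G$, $G\cup e$ contains it as an additional edge. -}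

module Defs where

open import Data.Bool using (Bool; true; false; if_then_else_; _∨_; _∧_)
open import Data.Nat using (ℕ; zero; suc; _≤ᵇ_; _<_; _≤_)
open import Data.Nat.Combinatorics using (_C_)
open import Data.Fin using (Fin; _≟_)
open import Data.Fin.Subset using (Subset; ⊤; ∣_∣)
open import Data.Vec using (Vec; []; _∷_; tabulate; lookup)
import Data.Vec as Vec
open import Data.List using (List; []; _∷_; [_]; map; _++_; filterᵇ; length; foldr)
open import Data.Product using (_×_; _,_)
open import Data.Integer using (+_)
open import Data.Rational using (ℚ; 0ℚ; _/_) renaming (_+_ to _+ℚ_; _*_ to _*ℚ_)
open import Relation.Nullary using (¬_; does)
open import Relation.Binary.PropositionalEquality using (_≡_; _≢_)

-- A finite digraph on the vertex set Fin n, with multiple edges (and loops)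
-- allowed: G u v is the number (multiplicity) of edges (u,v).
Digraph : ℕ → Set
Digraph n = Fin n → Fin n → ℕ

addEdge : ∀ {n} → Digraph n → Fin n × Fin n → Digraph n
addEdge G (a , b) u v =
  if does (u ≟ a) ∧ does (v ≟ b) then suc (G u v) else G u v

inDeg : ∀ {n} → Digraph n → Subset n → Fin n → ℕ
inDeg G S v = Vec.sum (tabulate (λ u → if lookup S u then G u v else 0))

step : ∀ {n} → Digraph n → ℕ → Subset n → Subset n
step G t S = tabulate (λ v → lookup S v ∨ (t ≤ᵇ inDeg G S v))

iter : ∀ {n} → Digraph n → ℕ → Subset n → ℕ → Subset n
iter G t S zero = S
iter G t S (suc i) = step G t (iter G t S i)

data ℕ∞ : Set where
  fin : ℕ → ℕ∞
  ∞   : ℕ∞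

data _≤∞_ : ℕ∞ → ℕ∞ → Set where
  fin≤fin : ∀ {m k} → m ≤ k → fin m ≤∞ fin k
  ≤∞-top  : ∀ {x} → x ≤∞ ∞

max∞ : ℕ∞ → ℕ∞ → ℕ∞
max∞ (fin m) (fin k) = fin (Data.Nat._⊔_ m k)
max∞ _ _ = ∞

IsDepth : ∀ {n} → Digraph n → ℕ → Subset n → ℕ∞ → Set
IsDepth G t S (fin i) = (iter G t S i ≡ ⊤) × (∀ j → j < i → iter G t S j ≢ ⊤)
IsDepth G t S ∞ = ∀ i → iter G t S i ≢ ⊤

IsDepthFun : ∀ {n} → Digraph n → ℕ → (Subset n → ℕ∞) → Set
IsDepthFun G t D = ∀ S → IsDepth G t S (D S)

allSubsets : ∀ n → List (Subset n)
allSubsets zero = [ [] ]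
allSubsets (suc n) = map (true ∷_) (allSubsets n) ++ map (false ∷_) (allSubsets n)

sSubsets : ∀ n → ℕ → List (Subset n)
sSubsets n s = filterᵇ (λ S → does (Data.Nat._≟_ ∣ S ∣ s)) (allSubsets n)

-- a / b as a rational (b = 0 gives 0; never used for 1 ≤ s < n)
ratio : ℕ → ℕ → ℚ
ratio a zero = 0ℚ
ratio a (suc b) = + a / suc b

isFin : ℕ∞ → Bool
isFin (fin _) = true
isFin ∞ = false

-- d^{-1} with ∞^{-1} = 0 (d = 0 cannot occur for s < n)
inv∞ : ℕ∞ → ℚ
inv∞ ∞ = 0ℚ
inv∞ (fin zero) = 0ℚ
inv∞ (fin (suc k)) = + 1 / suc k

pst : ∀ n → ℕ → (Subset n → ℕ∞) → ℚ
pst n s D = ratio (length (filterᵇ (λ S → isFin (D S)) (sSubsets n s))) (n C s)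

vst : ∀ n → ℕ → (Subset n → ℕ∞) → ℚ
vst n s D = foldr _+ℚ_ 0ℚ (map (λ S → inv∞ (D S)) (sSubsets n s)) *ℚ ratio 1 (n C s)

dst : ∀ n → ℕ → (Subset n → ℕ∞) → ℕ∞
dst n s D = foldr max∞ (fin 0) (map D (sSubsets n s))

-- Adding an edge can only raise in-degrees, so by induction every activated
-- set S_i of G is contained in the corresponding set of G ∪ e.  Hence each
-- d(S,t) can only drop, and the three quantities are monotone.  Depth 0
-- occurs only for S = V, whatever the digraph, so 1/d(S,t) can only grow even
-- with the convention 1/0 = 0.
module Submission where

open import Defs
open import Data.Bool using (Bool; true; false; if_then_else_; _∧_; _∨_; T)
open import Data.Bool.Properties using (T-∨; T-≡)
open import Data.Empty using (⊥-elim)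
open import Data.Fin using (Fin; _≟_)
import Data.Fin as Fin
open import Data.Fin.Subset using (Subset; ⊤; _∈_; _⊆_)
open import Data.Fin.Subset.Properties using (⊆-refl; ⊆-antisym; ⊆⊤)
open import Data.Integer using (+_)
import Data.Integer as ℤ
import Data.Integer.Properties as ℤ
open import Data.List using ([]; _∷_; map; filterᵇ; length; foldr)
open import Data.Nat.Combinatorics using (_C_)
open import Data.Nat using (ℕ; zero; suc; _≤_; _<_; _*_; _≤ᵇ_; z≤n; s≤s)
import Data.Nat.Properties as ℕ
open import Data.Product using (_×_; _,_)
import Data.Rational
open import Data.Rational using (ℚ; 0ℚ; _/_; NonNegative)
  renaming (_+_ to _+ℚ_; _≤_ to _≤ℚ_)
import Data.Rational.Properties as ℚ
import Data.Rational.Unnormalised as ℚᵘ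
import Data.Rational.Unnormalised.Properties as ℚᵘ
open import Data.Sum using (_⊎_)
import Data.Sum as Sum
open import Data.Vec using (tabulate; lookup)
import Data.Vec as Vec
open import Data.Vec.Properties using (lookup∘tabulate; []=⇒lookup; lookup⇒[]=)
open import Function using (_∘_)
open import Function.Bundles using (Equivalence)
open import Relation.Nullary using (does)
open import Relation.Binary.PropositionalEquality using (_≡_; refl; sym; subst; subst₂)

private
  variable
    n t : ℕ
    G H : Digraph n
    S S' : Subset n
    x y : ℕ∞

_⊑_ : Digraph n → Digraph n → Set
G ⊑ H = ∀ u v → G u v ≤ H u v

⊑-addEdge : (G : Digraph n) (e : Fin n × Fin n) → G ⊑ addEdge G e
⊑-addEdge G (a , b) u v with does (u ≟ a) ∧ does (v ≟ b)
... | true  = ℕ.n≤1+n (G u v)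
... | false = ℕ.≤-refl

∈⇒T-lookup : ∀ {v : Fin n} → v ∈ S → T (lookup S v)
∈⇒T-lookup v∈S = Equivalence.from T-≡ ([]=⇒lookup v∈S)

T-lookup⇒∈ : ∀ {v : Fin n} → T (lookup S v) → v ∈ S
T-lookup⇒∈ {S = S} {v} h = lookup⇒[]= v S (Equivalence.to T-≡ h)

sum-tabulate-mono-≤ : {f g : Fin n → ℕ} → (∀ i → f i ≤ g i) →
  Vec.sum (tabulate f) ≤ Vec.sum (tabulate g)
sum-tabulate-mono-≤ {zero}  f≤g = z≤n
sum-tabulate-mono-≤ {suc n} f≤g =
  ℕ.+-mono-≤ (f≤g Fin.zero) (sum-tabulate-mono-≤ (f≤g ∘ Fin.suc))

inDeg-mono : G ⊑ H → S ⊆ S' → ∀ v → inDeg G S v ≤ inDeg H S' v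
inDeg-mono {G = G} {H} {S} {S'} G⊑H S⊆S' v = sum-tabulate-mono-≤ fromActive
  where
  fromActive : ∀ u → (if lookup S u then G u v else 0) ≤ (if lookup S' u then H u v else 0)
  fromActive u with lookup S u in u∈S
  ... | false = z≤n
  ... | true rewrite []=⇒lookup (S⊆S' (lookup⇒[]= u S u∈S)) = G⊑H u v

lookup-step : ∀ v → lookup (step G t S) v ≡ lookup S v ∨ (t ≤ᵇ inDeg G S v)
lookup-step {G = G} {t} {S} v = lookup∘tabulate (λ w → lookup S w ∨ (t ≤ᵇ inDeg G S w)) v

∈-step⁻ : ∀ {v} → v ∈ step G t S → v ∈ S ⊎ t ≤ inDeg G S v
∈-step⁻ {G = G} {t} {S} {v} v∈ =
  Sum.map T-lookup⇒∈ (ℕ.≤ᵇ⇒≤ t (inDeg G S v))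
    (Equivalence.to T-∨ (subst T (lookup-step {G = G} {t = t} {S = S} v) (∈⇒T-lookup v∈)))

∈-step⁺ : ∀ {v} → v ∈ S ⊎ t ≤ inDeg G S v → v ∈ step G t S
∈-step⁺ {S = S} {t} {G} {v} h =
  T-lookup⇒∈ (subst T (sym (lookup-step {G = G} {t = t} {S = S} v))
    (Equivalence.from T-∨ (Sum.map ∈⇒T-lookup ℕ.≤⇒≤ᵇ h)))

step-mono : G ⊑ H → S ⊆ S' → step G t S ⊆ step H t S'
step-mono {G = G} {H} {S} {S'} {t} G⊑H S⊆S' {v} =
  ∈-step⁺ {S = S'} {t} {H}
    ∘ Sum.map S⊆S' (λ t≤d → ℕ.≤-trans t≤d (inDeg-mono G⊑H S⊆S' v))
    ∘ ∈-step⁻ {G = G}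

iter-mono : G ⊑ H → S ⊆ S' → ∀ i → iter G t S i ⊆ iter H t S' i
iter-mono G⊑H S⊆S' zero    = S⊆S'
iter-mono {G = G} {H} {t = t} G⊑H S⊆S' (suc i) =
  step-mono {G = G} {H} {t = t} G⊑H (iter-mono G⊑H S⊆S' i)

synchronized-mono : G ⊑ H → S ⊆ S' → ∀ i → iter G t S i ≡ ⊤ → iter H t S' i ≡ ⊤
synchronized-mono {H = H} {S' = S'} {t = t} G⊑H S⊆S' i eq =
  ⊆-antisym ⊆⊤ (subst (_⊆ iter H t S' i) eq (iter-mono G⊑H S⊆S' i))

depth-least : ∀ {i} → IsDepth G t S x → iter G t S i ≡ ⊤ → x ≤∞ fin i
depth-least {x = fin j} {i = i} (_ , minimal) eq = fin≤fin (ℕ.≮⇒≥ (λ i<j → minimal i i<j eq))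
depth-least {x = ∞}     {i = i} never         eq = ⊥-elim (never i eq)

depth-mono : G ⊑ H → S ⊆ S' → IsDepth G t S y → IsDepth H t S' x → x ≤∞ y
depth-mono {y = fin i} G⊑H S⊆S' (eq , _) dx = depth-least dx (synchronized-mono G⊑H S⊆S' i eq)
depth-mono {y = ∞}     _   _    _        _  = ≤∞-top

depth-zero : IsDepth G t S (fin 0) → IsDepth H t S y → y ≡ fin 0
depth-zero (S≡⊤ , _) dy with depth-least {i = 0} dy S≡⊤
... | fin≤fin z≤n = refl

≤∞-isFin : x ≤∞ y → T (isFin y) → T (isFin x)
≤∞-isFin (fin≤fin _) _ = _

max∞-mono : ∀ {x x' y y'} → x ≤∞ x' → y ≤∞ y' → max∞ x y ≤∞ max∞ x' y'
max∞-mono (fin≤fin x≤x') (fin≤fin y≤y') = fin≤fin (ℕ.⊔-mono-≤ x≤x' y≤y')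
max∞-mono (fin≤fin _) ≤∞-top = ≤∞-top
max∞-mono ≤∞-top _ = ≤∞-top

cross-≤⇒/-≤ : ∀ a b c d → a * suc d ≤ c * suc b → + a / suc b ≤ℚ + c / suc d
cross-≤⇒/-≤ a b c d ad≤cb = ℚ.toℚᵘ-cancel-≤
  (ℚᵘ.≤-respʳ-≃ (ℚᵘ.≃-sym (ℚ.toℚᵘ-fromℚᵘ (ℚᵘ.mkℚᵘ (+ c) d)))
    (ℚᵘ.≤-respˡ-≃ (ℚᵘ.≃-sym (ℚ.toℚᵘ-fromℚᵘ (ℚᵘ.mkℚᵘ (+ a) b)))
      (ℚᵘ.*≤* (subst₂ ℤ._≤_ (ℤ.pos-* a (suc d)) (ℤ.pos-* c (suc b)) (ℤ.+≤+ ad≤cb)))))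

ratio-monoˡ : ∀ {a c} k → a ≤ c → ratio a k ≤ℚ ratio c k
ratio-monoˡ zero    _   = ℚ.≤-refl
ratio-monoˡ {a} {c} (suc k) a≤c = cross-≤⇒/-≤ a k c k (ℕ.*-monoˡ-≤ (suc k) a≤c)

ratio-nonNeg : ∀ a k → NonNegative (ratio a k)
ratio-nonNeg a zero    = _
ratio-nonNeg a (suc k) = ℚ.normalize-nonNeg a (suc k)

inv∞-nonNeg : ∀ x → 0ℚ ≤ℚ inv∞ x
inv∞-nonNeg ∞             = ℚ.≤-refl
inv∞-nonNeg (fin zero)    = ℚ.≤-refl
inv∞-nonNeg (fin (suc k)) = cross-≤⇒/-≤ 0 0 1 k z≤n

inv∞-antitone : x ≤∞ y → (x ≡ fin 0 → y ≡ fin 0) → inv∞ y ≤ℚ inv∞ x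
inv∞-antitone {x = x} ≤∞-top _ = inv∞-nonNeg x
inv∞-antitone {x = fin zero} (fin≤fin _) zero-pres with zero-pres refl
... | refl = ℚ.≤-refl
inv∞-antitone {x = fin (suc j)} {fin (suc i)} (fin≤fin j≤i) _ =
  cross-≤⇒/-≤ 1 i 1 j (ℕ.*-monoʳ-≤ 1 j≤i)

length-filterᵇ-mono : ∀ {A : Set} {p q : A → Bool} → (∀ a → T (p a) → T (q a)) → ∀ xs →
  length (filterᵇ p xs) ≤ length (filterᵇ q xs)
length-filterᵇ-mono p⇒q [] = z≤n
length-filterᵇ-mono {p = p} {q} p⇒q (a ∷ xs) with p a in pa | q a in qa
... | true  | true  = s≤s (length-filterᵇ-mono p⇒q xs)
... | true  | false = ⊥-elim (subst T qa (p⇒q a (subst T (sym pa) _)))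
... | false | true  = ℕ.m≤n⇒m≤1+n (length-filterᵇ-mono p⇒q xs)
... | false | false = length-filterᵇ-mono p⇒q xs

foldr-max∞-mono : ∀ {A : Set} {f g : A → ℕ∞} → (∀ a → f a ≤∞ g a) → ∀ xs →
  foldr max∞ (fin 0) (map f xs) ≤∞ foldr max∞ (fin 0) (map g xs)
foldr-max∞-mono f≤g []       = fin≤fin z≤n
foldr-max∞-mono f≤g (a ∷ xs) = max∞-mono (f≤g a) (foldr-max∞-mono f≤g xs)

foldr-+ℚ-mono : ∀ {A : Set} {f g : A → ℚ} → (∀ a → f a ≤ℚ g a) → ∀ xs →
  foldr _+ℚ_ 0ℚ (map f xs) ≤ℚ foldr _+ℚ_ 0ℚ (map g xs)
foldr-+ℚ-mono f≤g []       = ℚ.≤-refl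
foldr-+ℚ-mono f≤g (a ∷ xs) = ℚ.+-mono-≤ (f≤g a) (foldr-+ℚ-mono f≤g xs)

pst-mono : ∀ n s {D D' : Subset n → ℕ∞} → (∀ S → D' S ≤∞ D S) → pst n s D ≤ℚ pst n s D'
pst-mono n s D'≤D =
  ratio-monoˡ (n C s) (length-filterᵇ-mono (λ S → ≤∞-isFin (D'≤D S)) (sSubsets n s))

dst-mono : ∀ n s {D D' : Subset n → ℕ∞} → (∀ S → D' S ≤∞ D S) → dst n s D' ≤∞ dst n s D
dst-mono n s D'≤D = foldr-max∞-mono D'≤D (sSubsets n s)

vst-mono : ∀ n s {D D' : Subset n → ℕ∞} → (∀ S → inv∞ (D S) ≤ℚ inv∞ (D' S)) →
  vst n s D ≤ℚ vst n s D'
vst-mono n s invD≤invD' = ℚ.*-monoʳ-≤-nonNeg (ratio 1 (n C s)) {{ratio-nonNeg 1 (n C s)}}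
  (foldr-+ℚ-mono invD≤invD' (sSubsets n s))

proposition2 : ∀ {n} (G : Digraph n) (e : Fin n × Fin n) (s t : ℕ) → 1 ≤ s → s < n →
    (D De : Subset n → ℕ∞) → IsDepthFun G t D → IsDepthFun (addEdge G e) t De →
    (Data.Rational._≤_ (pst n s D) (pst n s De))
      × (dst n s De ≤∞ dst n s D)
      × (Data.Rational._≤_ (vst n s D) (vst n s De))
proposition2 {n} G e s t _ _ D De isDepth isDepthₑ =
  pst-mono n s De≤D , dst-mono n s De≤D , vst-mono n s {D} {De} invD≤invDe
  where
  De≤D : ∀ S → De S ≤∞ D S
  De≤D S = depth-mono (⊑-addEdge G e) ⊆-refl (isDepth S) (isDepthₑ S)

  invD≤invDe : ∀ S → inv∞ (D S) ≤ℚ inv∞ (De S)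
  invD≤invDe S = inv∞-antitone (De≤D S) λ De≡0 →
    depth-zero (subst (IsDepth _ t S) De≡0 (isDepthₑ S)) (isDepth S)
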